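{- Let $e$ be an environment and $n\ge 1$ a de Bruijn index such that $n[e]$ is closed. Then $\mathrm{er}(n[e])\to^*_{\mathrm{CAU}^-_\sigma}e(n)$.
   Context: The calculus $\mathrm{CAU}^-_\sigma$ uses nameless (de Bruijn) syntax: Terms $M,N ::= 1 \mid \lambda.M \mid M\,N \mid \mathsf{let}(M,N) \mid !_q M \mid q \triangleright M \mid \iota(\vartheta) \mid M[s] \mid \mathrm{er}(M)$; Trails $q ::= \mathsf{r} \mid \mathsf{t}(q,q') \mid \mathsf{ba} \mid \mathsf{bb} \mid \mathsf{ti} \mid \mathsf{lam}(q) \mid \mathsf{app}(q,q') \mid \mathsf{let}(q,q') \mid \mathsf{tr}(\zeta) \mid \mathrm{tl}(M)$; Substitutions $s,t ::= \langle\rangle \mid {\uparrow} \mid M\cdot s \mid s\circ t$. $\lambda$ binds index 1 of its body; $\mathsf{let}(M,N)$ binds index 1 in $N$; $\vartheta$ (resp. $\zeta$) is a family of nine terms (resp. trails) indexed by the constructors in the order $\mathsf{r},\mathsf{t},\mathsf{ba},\mathsf{bb},\mathsf{ti},\mathsf{lam},\mathsf{app},\mathsf{let},\mathsf{tr}$. ${\uparrow}^n={\uparrow}\circ\cdots\circ{\uparrow}$; de Bruijn index $n$ is $1[{\uparrow}^{n-1}]$ (index 1 is $1$); $M[N]$ abbreviates $M[N\cdot\langle\rangle]$. $\sigma$-rules: $1[\langle\rangle]\to 1$; $1[M\cdot s]\to M$; $(\lambda.M)[s]\to \lambda.(M[1\cdot(s\circ{\uparrow})])$; $(M\,N)[s]\to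 M[s]\,N[s]$; $(!_qM)[s]\to !_q(M[s])$; $\mathsf{let}(M,N)[s]\to\mathsf{let}(M[s],N[1\cdot(s\circ{\uparrow})])$; $(q\triangleright M)[s]\to q\triangleright(M[s])$; $\iota(\{M_i\})[s]\to\iota(\{M_i[s]\})$; $M[s][t]\to M[s\circ t]$; $\langle\rangle\circ s\to s$; ${\uparrow}\circ\langle\rangle\to{\uparrow}$; ${\uparrow}\circ(M\cdot s)\to s$; $(M\cdot s)\circ t\to M[t]\cdot(s\circ t)$; $(s_1\circ s_2)\circ s_3\to s_1\circ(s_2\circ s_3)$; $\mathrm{er}(1)\to 1$; $\mathrm{er}(1[{\uparrow}^n])\to 1[{\uparrow}^n]$; $\mathrm{er}(\lambda.M)\to\lambda.\mathrm{er}(M)$; $\mathrm{er}(M\,N)\to\mathrm{er}(M)\,\mathrm{er}(N)$; $\mathrm{er}(!_qM)\to !_qM$; $\mathrm{er}(\mathsf{let}(M,N))\to\mathsf{let}(\mathrm{er}(M),\mathrm{er}(N))$; $\mathrm{er}(q\triangleright M)\to\mathrm{er}(M)$; $\mathrm{er}(\iota(\{M_i\}))\to\iota(\{\mathrm{er}(M_i)\})$; $\mathrm{tl}(1)\to\mathsf{r}$; $\mathrm{tl}(1[{\uparrow}^n])\to\mathsf{r}$; $\mathrm{tl}(\lambda.M)\to\mathsf{lam}(\mathrm{tl}(M))$; $\mathrm{tl}(M\,N)\to\mathsf{app}(\mathrm{tl}(M),\mathrm{tl}(N))$; $\mathrm{tl}(!_qM)\to\mathsf{r}$; $\mathrm{tl}(\mathsf{let}(M,N))\to\mathsf{let}(\mathrm{tl}(M),\mathrm{tl}(N))$;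 $\mathrm{tl}(q\triangleright M)\to\mathsf{t}(q,\mathrm{tl}(M))$; $\mathrm{tl}(\iota(\{M_i\}))\to\mathsf{tr}(\{\mathrm{tl}(M_i)\})$. $\tau$-rules: $\mathsf{r}\triangleright M\to M$; $q\triangleright(q'\triangleright M)\to\mathsf{t}(q,q')\triangleright M$; $!_q(q'\triangleright M)\to !_{\mathsf{t}(q,q')}M$; $\lambda.(q\triangleright M)\to\mathsf{lam}(q)\triangleright\lambda.M$; $(q\triangleright M)\,N\to\mathsf{app}(q,\mathsf{r})\triangleright M\,N$; $M\,(q\triangleright N)\to\mathsf{app}(\mathsf{r},q)\triangleright M\,N$; $\mathsf{let}(q\triangleright M,N)\to\mathsf{let}(q,\mathsf{r})\triangleright\mathsf{let}(M,N)$; $\mathsf{let}(M,q\triangleright N)\to\mathsf{let}(\mathsf{r},q)\triangleright\mathsf{let}(M,N)$; $\iota(\{M_1,\dots,q\triangleright M_i,\dots,M_9\})\to\mathsf{tr}(\{\mathsf{r},\dots,q,\dots,\mathsf{r}\})\triangleright\iota(\{M_1,\dots,M_9\})$; $\mathsf{t}(q,\mathsf{r})\to q$; $\mathsf{t}(\mathsf{r},q)\to q$; $\mathsf{tr}(\{\mathsf{r},\dots,\mathsf{r}\})\to\mathsf{r}$; $\mathsf{app}(\mathsf{r},\mathsf{r})\to\mathsf{r}$; $\mathsf{lam}(\mathsf{r})\to\mathsf{r}$; $\mathsf{let}(\mathsf{r},\mathsf{r})\to\mathsf{r}$; $\mathsf{t}(\mathsf{t}(q_1,q_2),q_3)\to\mathsf{t}(q_1,\mathsf{t}(q_2,q_3))$;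 $\mathsf{t}(\mathsf{lam}(q),\mathsf{lam}(q'))\to\mathsf{lam}(\mathsf{t}(q,q'))$; $\mathsf{t}(\mathsf{lam}(q_1),\mathsf{t}(\mathsf{lam}(q_1'),q))\to\mathsf{t}(\mathsf{lam}(\mathsf{t}(q_1,q_1')),q)$; $\mathsf{t}(\mathsf{app}(q_1,q_2),\mathsf{app}(q_1',q_2'))\to\mathsf{app}(\mathsf{t}(q_1,q_1'),\mathsf{t}(q_2,q_2'))$; $\mathsf{t}(\mathsf{app}(q_1,q_2),\mathsf{t}(\mathsf{app}(q_1',q_2'),q))\to\mathsf{t}(\mathsf{app}(\mathsf{t}(q_1,q_1'),\mathsf{t}(q_2,q_2')),q)$; the same two with $\mathsf{let}$ for $\mathsf{app}$; $\mathsf{t}(\mathsf{tr}(\{q_i\}),\mathsf{tr}(\{q_i'\}))\to\mathsf{tr}(\{\mathsf{t}(q_i,q_i')\})$; $\mathsf{t}(\mathsf{tr}(\{q_i\}),\mathsf{t}(\mathsf{tr}(\{q_i'\}),q))\to\mathsf{t}(\mathsf{tr}(\{\mathsf{t}(q_i,q_i')\}),q)$. Both apply anywhere; $\equiv_{\sigma\tau}$ is the equivalence closure of $\to_\sigma\cup\to_\tau$; $\sigma\cup\tau$ is terminating and confluent, $\sigma\tau(X)$ is the normal form. For a trail $q$ without $\mathrm{tl}$: $\mathsf{r}\vartheta=\vartheta(\mathsf{r})$, $\mathsf{ba}\vartheta=\vartheta(\mathsf{ba})$, $\mathsf{bb}\vartheta=\vartheta(\mathsf{bb})$, $\mathsf{ti}\vartheta=\vartheta(\mathsf{ti})$,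 $\mathsf{lam}(q)\vartheta=\vartheta(\mathsf{lam})\,(q\vartheta)$, $c(q,q')\vartheta=\vartheta(c)\,(q\vartheta)\,(q'\vartheta)$ for $c\in\{\mathsf{t},\mathsf{app},\mathsf{let}\}$, $\mathsf{tr}(\{q_1,\dots,q_9\})\vartheta=\vartheta(\mathsf{tr})\,(q_1\vartheta)\cdots(q_9\vartheta)$. Beta-reduction: with $F ::= \blacksquare \mid \lambda.F \mid F\,N \mid M\,F \mid \mathsf{let}(F,N) \mid \mathsf{let}(M,F) \mid q\triangleright F \mid \iota(\{\vec M,F,\vec N\}) \mid F[s]$: $(\lambda.M)\,N\to_{\mathrm{Beta}}\mathsf{t}(\mathsf{app}(\mathsf{lam}(\mathrm{tl}(M)),\mathrm{tl}(N)),\mathsf{ba})\triangleright\mathrm{er}(M)[\mathrm{er}(N)]$; $\mathsf{let}(!_qM,N)\to_{\mathrm{Beta}}\mathsf{t}(\mathsf{let}(\mathsf{r},\mathrm{tl}(N)),\mathsf{bb})\triangleright\mathrm{er}(N)[q\triangleright M]$; $!_qF[\iota(\vartheta)]\to_{\mathrm{Beta}}!_qF[\mathsf{ti}\triangleright q'\vartheta]$ with $q'=\sigma\tau(\mathsf{t}(q,\mathrm{tl}(F[\iota(\vartheta)])))$; closed under $E_\sigma ::= \blacksquare \mid \lambda.E_\sigma \mid E_\sigma\,N \mid M\,E_\sigma \mid \mathsf{let}(E_\sigma,N) \mid \mathsf{let}(M,E_\sigma) \mid !_qE_\sigma \mid q\triangleright E_\sigma \mid \iota(\{\vec M,E_\sigma,\vec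 N\}) \mid E_\sigma[s] \mid M[S_\sigma]$, $S_\sigma ::= S_\sigma\circ t \mid s\circ S_\sigma \mid E_\sigma\cdot s \mid M\cdot S_\sigma$. $\to_{\mathrm{CAU}^-_\sigma}\;=\;\to_{\mathrm{Beta}}\cup\equiv_{\sigma\tau}$. Pure terms are terms built from de Bruijn indices, $\lambda$, application, $\mathsf{let}$, $!_q$, $q\triangleright$ and $\iota$, with no explicit substitution, erasure or trail extraction. Closures $C ::= \mathrm{er}((\lambda.M)[e]) \mid !_qC$ with $M$ pure; values $V ::= q\triangleright C$; environments $e ::= \langle\rangle \mid V\cdot e$. Lookup: $e(n)=C$ if $e=(q\triangleright C)\cdot e'$ and $n=1$; $e(n)=e'(m)$ if $e=V\cdot e'$ and $n=m+1$. A term is closed if it has no free de Bruijn indices. -}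

module Defs where

open import Data.Nat using (ℕ; zero; suc)
open import Data.Fin using (Fin) renaming (zero to f0; suc to fs)
open import Data.Vec using (Vec; []; _∷_; lookup; _[_]≔_; replicate; map; zipWith; foldl)
open import Data.Maybe using (Maybe; just; nothing)
open import Data.Product using (_×_; Σ)
open import Data.Sum using (_⊎_)
open import Relation.Nullary using (¬_)
open import Relation.Binary.PropositionalEquality using (_≡_)
open import Relation.Binary.Construct.Closure.ReflexiveTransitive using (Star)
open import Relation.Binary.Construct.Closure.Equivalence using (EqClosure)

-- Syntax of CAU⁻_σ (nameless).  The families ϑ / ζ are vectors of length
-- nine, indexed by the trail constructors in the order
--   r, t, ba, bb, ti, lam, app, let, tr   (positions 0 … 8).

infixl 7 _·_
infixl 8 _⟦_⟧
infixr 5 _•_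
infixr 6 _∘ₛ_
infixr 4 _▷_

mutual
  data Term : Set where
    one   : Term
    ƛ     : Term → Term
    _·_   : Term → Term → Term
    tlet  : Term → Term → Term         -- let(M,N), binds index 1 in N
    bang  : Trail → Term → Term
    _▷_   : Trail → Term → Term
    ι     : Vec Term 9 → Term
    _⟦_⟧  : Term → Subst → Term
    er    : Term → Term

  data Trail : Set where
    r    : Trail
    t    : Trail → Trail → Trail
    ba   : Trail
    bb   : Trail
    ti   : Trail
    lam  : Trail → Trail
    app  : Trail → Trail → Trail
    qlet : Trail → Trail → Trail
    tr   : Vec Trail 9 → Trail
    tl   : Term → Trail

  data Subst : Set where
    ⟨⟩    : Subst
    ↑     : Subst
    _•_   : Term → Subst → Subst
    _∘ₛ_  : Subst → Subst → Subst

-- ↑^(k+1) = ↑ ∘ (↑ ∘ (… ∘ ↑))   (right nested)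
ups : ℕ → Subst
ups zero    = ↑
ups (suc k) = ↑ ∘ₛ ups k

-- de Bruijn index n (n ≥ 1) is 1[↑^(n-1)]; index 1 is 1.
-- (idx 0 is junk and is never used: the statement assumes n ≥ 1.)
idx : ℕ → Term
idx zero          = one
idx (suc zero)    = one
idx (suc (suc k)) = one ⟦ ups k ⟧

_⟦_⟧₁ : Term → Term → Term
M ⟦ N ⟧₁ = M ⟦ N • ⟨⟩ ⟧

mutual
  data RootT : Term → Term → Set where
    σ-id    : RootT (one ⟦ ⟨⟩ ⟧) one
    σ-cons  : ∀ {M s} → RootT (one ⟦ M • s ⟧) M
    σ-lam   : ∀ {M s} → RootT (ƛ M ⟦ s ⟧) (ƛ (M ⟦ one • (s ∘ₛ ↑) ⟧))
    σ-app   : ∀ {M N s} → RootT ((M · N) ⟦ s ⟧) (M ⟦ s ⟧ · N ⟦ s ⟧)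
    σ-bang  : ∀ {q M s} → RootT (bang q M ⟦ s ⟧) (bang q (M ⟦ s ⟧))
    σ-let   : ∀ {M N s} → RootT (tlet M N ⟦ s ⟧) (tlet (M ⟦ s ⟧) (N ⟦ one • (s ∘ₛ ↑) ⟧))
    σ-trl   : ∀ {q M s} → RootT ((q ▷ M) ⟦ s ⟧) (q ▷ (M ⟦ s ⟧))
    σ-ι     : ∀ {ϑ s} → RootT (ι ϑ ⟦ s ⟧) (ι (map (λ M → M ⟦ s ⟧) ϑ))
    σ-clos  : ∀ {M s s'} → RootT (M ⟦ s ⟧ ⟦ s' ⟧) (M ⟦ s ∘ₛ s' ⟧)
    er-one  : RootT (er one) one
    er-var  : ∀ k → RootT (er (one ⟦ ups k ⟧)) (one ⟦ ups k ⟧)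
    er-lam  : ∀ {M} → RootT (er (ƛ M)) (ƛ (er M))
    er-app  : ∀ {M N} → RootT (er (M · N)) (er M · er N)
    er-bang : ∀ {q M} → RootT (er (bang q M)) (bang q M)
    er-let  : ∀ {M N} → RootT (er (tlet M N)) (tlet (er M) (er N))
    er-trl  : ∀ {q M} → RootT (er (q ▷ M)) (er M)
    er-ι    : ∀ {ϑ} → RootT (er (ι ϑ)) (ι (map er ϑ))
    τ-r     : ∀ {M} → RootT (r ▷ M) M
    τ-tt    : ∀ {q q' M} → RootT (q ▷ (q' ▷ M)) (t q q' ▷ M)
    τ-bang  : ∀ {q q' M} → RootT (bang q (q' ▷ M)) (bang (t q q') M)
    τ-lam   : ∀ {q M} → RootT (ƛ (q ▷ M)) (lam q ▷ ƛ M)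
    τ-appL  : ∀ {q M N} → RootT ((q ▷ M) · N) (app q r ▷ M · N)
    τ-appR  : ∀ {q M N} → RootT (M · (q ▷ N)) (app r q ▷ M · N)
    τ-letL  : ∀ {q M N} → RootT (tlet (q ▷ M) N) (qlet q r ▷ tlet M N)
    τ-letR  : ∀ {q M N} → RootT (tlet M (q ▷ N)) (qlet r q ▷ tlet M N)
    τ-ι     : ∀ {ϑ q M} (i : Fin 9) → lookup ϑ i ≡ (q ▷ M) →
              RootT (ι ϑ) (tr (replicate 9 r [ i ]≔ q) ▷ ι (ϑ [ i ]≔ M))

  data RootQ : Trail → Trail → Set where
    tl-one  : RootQ (tl one) r
    tl-var  : ∀ k → RootQ (tl (one ⟦ ups k ⟧)) r
    tl-lam  : ∀ {M} → RootQ (tl (ƛ M)) (lam (tl M))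
    tl-app  : ∀ {M N} → RootQ (tl (M · N)) (app (tl M) (tl N))
    tl-bang : ∀ {q M} → RootQ (tl (bang q M)) r
    tl-let  : ∀ {M N} → RootQ (tl (tlet M N)) (qlet (tl M) (tl N))
    tl-trl  : ∀ {q M} → RootQ (tl (q ▷ M)) (t q (tl M))
    tl-ι    : ∀ {ϑ} → RootQ (tl (ι ϑ)) (tr (map tl ϑ))
    t-r₂    : ∀ {q} → RootQ (t q r) q
    t-r₁    : ∀ {q} → RootQ (t r q) q
    tr-r    : RootQ (tr (replicate 9 r)) r
    app-r   : RootQ (app r r) r
    lam-r   : RootQ (lam r) r
    let-r   : RootQ (qlet r r) r
    t-assoc : ∀ {q₁ q₂ q₃} → RootQ (t (t q₁ q₂) q₃) (t q₁ (t q₂ q₃))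
    t-lam   : ∀ {q q'} → RootQ (t (lam q) (lam q')) (lam (t q q'))
    t-lam'  : ∀ {q₁ q₁' q} → RootQ (t (lam q₁) (t (lam q₁') q)) (t (lam (t q₁ q₁')) q)
    t-app   : ∀ {q₁ q₂ q₁' q₂'} →
              RootQ (t (app q₁ q₂) (app q₁' q₂')) (app (t q₁ q₁') (t q₂ q₂'))
    t-app'  : ∀ {q₁ q₂ q₁' q₂' q} →
              RootQ (t (app q₁ q₂) (t (app q₁' q₂') q)) (t (app (t q₁ q₁') (t q₂ q₂')) q)
    t-let   : ∀ {q₁ q₂ q₁' q₂'} →
              RootQ (t (qlet q₁ q₂) (qlet q₁' q₂')) (qlet (t q₁ q₁') (t q₂ q₂'))
    t-let'  : ∀ {q₁ q₂ q₁' q₂' q} →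
              RootQ (t (qlet q₁ q₂) (t (qlet q₁' q₂') q)) (t (qlet (t q₁ q₁') (t q₂ q₂')) q)
    t-tr    : ∀ {ζ ζ'} → RootQ (t (tr ζ) (tr ζ')) (tr (zipWith t ζ ζ'))
    t-tr'   : ∀ {ζ ζ' q} → RootQ (t (tr ζ) (t (tr ζ') q)) (t (tr (zipWith t ζ ζ')) q)

  data RootS : Subst → Subst → Set where
    s-idL   : ∀ {s} → RootS (⟨⟩ ∘ₛ s) s
    s-shid  : RootS (↑ ∘ₛ ⟨⟩) ↑
    s-shcons : ∀ {M s} → RootS (↑ ∘ₛ (M • s)) s
    s-map   : ∀ {M s s'} → RootS ((M • s) ∘ₛ s') (M ⟦ s' ⟧ • (s ∘ₛ s'))
    s-assoc : ∀ {s₁ s₂ s₃} → RootS ((s₁ ∘ₛ s₂) ∘ₛ s₃) (s₁ ∘ₛ (s₂ ∘ₛ s₃))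

infix 3 _⟶στ_ _⟶στq_ _⟶στs_

mutual
  data _⟶στ_ : Term → Term → Set where
    root  : ∀ {M N} → RootT M N → M ⟶στ N
    c-lam : ∀ {M M'} → M ⟶στ M' → ƛ M ⟶στ ƛ M'
    c-appL : ∀ {M M' N} → M ⟶στ M' → M · N ⟶στ M' · N
    c-appR : ∀ {M N N'} → N ⟶στ N' → M · N ⟶στ M · N'
    c-letL : ∀ {M M' N} → M ⟶στ M' → tlet M N ⟶στ tlet M' N
    c-letR : ∀ {M N N'} → N ⟶στ N' → tlet M N ⟶στ tlet M N'
    c-bangQ : ∀ {q q' M} → q ⟶στq q' → bang q M ⟶στ bang q' M
    c-bangM : ∀ {q M M'} → M ⟶στ M' → bang q M ⟶στ bang q M'
    c-trlQ : ∀ {q q' M} → q ⟶στq q' → q ▷ M ⟶στ q' ▷ M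
    c-trlM : ∀ {q M M'} → M ⟶στ M' → q ▷ M ⟶στ q ▷ M'
    c-ι   : ∀ {ϑ M'} (i : Fin 9) → lookup ϑ i ⟶στ M' → ι ϑ ⟶στ ι (ϑ [ i ]≔ M')
    c-subM : ∀ {M M' s} → M ⟶στ M' → M ⟦ s ⟧ ⟶στ M' ⟦ s ⟧
    c-subS : ∀ {M s s'} → s ⟶στs s' → M ⟦ s ⟧ ⟶στ M ⟦ s' ⟧
    c-er  : ∀ {M M'} → M ⟶στ M' → er M ⟶στ er M'

  data _⟶στq_ : Trail → Trail → Set where
    root  : ∀ {q q'} → RootQ q q' → q ⟶στq q'
    c-tL  : ∀ {q₁ q₁' q₂} → q₁ ⟶στq q₁' → t q₁ q₂ ⟶στq t q₁' q₂
    c-tR  : ∀ {q₁ q₂ q₂'} → q₂ ⟶στq q₂' → t q₁ q₂ ⟶στq t q₁ q₂'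
    c-lam : ∀ {q q'} → q ⟶στq q' → lam q ⟶στq lam q'
    c-appL : ∀ {q₁ q₁' q₂} → q₁ ⟶στq q₁' → app q₁ q₂ ⟶στq app q₁' q₂
    c-appR : ∀ {q₁ q₂ q₂'} → q₂ ⟶στq q₂' → app q₁ q₂ ⟶στq app q₁ q₂'
    c-letL : ∀ {q₁ q₁' q₂} → q₁ ⟶στq q₁' → qlet q₁ q₂ ⟶στq qlet q₁' q₂
    c-letR : ∀ {q₁ q₂ q₂'} → q₂ ⟶στq q₂' → qlet q₁ q₂ ⟶στq qlet q₁ q₂'
    c-tr  : ∀ {ζ q'} (i : Fin 9) → lookup ζ i ⟶στq q' → tr ζ ⟶στq tr (ζ [ i ]≔ q')
    c-tl  : ∀ {M M'} → M ⟶στ M' → tl M ⟶στq tl M'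

  data _⟶στs_ : Subst → Subst → Set where
    root  : ∀ {s s'} → RootS s s' → s ⟶στs s'
    c-consM : ∀ {M M' s} → M ⟶στ M' → M • s ⟶στs M' • s
    c-consS : ∀ {M s s'} → s ⟶στs s' → M • s ⟶στs M • s'
    c-compL : ∀ {s s' u} → s ⟶στs s' → s ∘ₛ u ⟶στs s' ∘ₛ u
    c-compR : ∀ {s u u'} → u ⟶στs u' → s ∘ₛ u ⟶στs s ∘ₛ u'

_≡στ_ : Term → Term → Set
_≡στ_ = EqClosure _⟶στ_

IsNFOf : Trail → Trail → Set
IsNFOf q q' = Star _⟶στq_ q q' × (∀ q'' → ¬ (q' ⟶στq q''))

-- qϑ for trails without tl (as a relation: TrailApp ϑ q P means qϑ = P;
-- it is undefined on trails containing tl)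

ϑr ϑt ϑba ϑbb ϑti ϑlam ϑapp ϑlet ϑtr : Vec Term 9 → Term
ϑr   ϑ = lookup ϑ f0
ϑt   ϑ = lookup ϑ (fs f0)
ϑba  ϑ = lookup ϑ (fs (fs f0))
ϑbb  ϑ = lookup ϑ (fs (fs (fs f0)))
ϑti  ϑ = lookup ϑ (fs (fs (fs (fs f0))))
ϑlam ϑ = lookup ϑ (fs (fs (fs (fs (fs f0)))))
ϑapp ϑ = lookup ϑ (fs (fs (fs (fs (fs (fs f0))))))
ϑlet ϑ = lookup ϑ (fs (fs (fs (fs (fs (fs (fs f0)))))))
ϑtr  ϑ = lookup ϑ (fs (fs (fs (fs (fs (fs (fs (fs f0))))))))

data TrailApp (ϑ : Vec Term 9) : Trail → Term → Set where
  a-r   : TrailApp ϑ r (ϑr ϑ)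
  a-t   : ∀ {q q' P P'} → TrailApp ϑ q P → TrailApp ϑ q' P' → TrailApp ϑ (t q q') (ϑt ϑ · P · P')
  a-ba  : TrailApp ϑ ba (ϑba ϑ)
  a-bb  : TrailApp ϑ bb (ϑbb ϑ)
  a-ti  : TrailApp ϑ ti (ϑti ϑ)
  a-lam : ∀ {q P} → TrailApp ϑ q P → TrailApp ϑ (lam q) (ϑlam ϑ · P)
  a-app : ∀ {q q' P P'} → TrailApp ϑ q P → TrailApp ϑ q' P' → TrailApp ϑ (app q q') (ϑapp ϑ · P · P')
  a-let : ∀ {q q' P P'} → TrailApp ϑ q P → TrailApp ϑ q' P' → TrailApp ϑ (qlet q q') (ϑlet ϑ · P · P')
  a-tr  : ∀ {q₁ q₂ q₃ q₄ q₅ q₆ q₇ q₈ q₉ P₁ P₂ P₃ P₄ P₅ P₆ P₇ P₈ P₉} →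
          TrailApp ϑ q₁ P₁ → TrailApp ϑ q₂ P₂ → TrailApp ϑ q₃ P₃ →
          TrailApp ϑ q₄ P₄ → TrailApp ϑ q₅ P₅ → TrailApp ϑ q₆ P₆ →
          TrailApp ϑ q₇ P₇ → TrailApp ϑ q₈ P₈ → TrailApp ϑ q₉ P₉ →
          TrailApp ϑ (tr (q₁ ∷ q₂ ∷ q₃ ∷ q₄ ∷ q₅ ∷ q₆ ∷ q₇ ∷ q₈ ∷ q₉ ∷ []))
                     (ϑtr ϑ · P₁ · P₂ · P₃ · P₄ · P₅ · P₆ · P₇ · P₈ · P₉)

data FCtx : Set where
  ■     : FCtx
  f-lam : FCtx → FCtx
  f-appL : FCtx → Term → FCtx
  f-appR : Term → FCtx → FCtx
  f-letL : FCtx → Term → FCtx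
  f-letR : Term → FCtx → FCtx
  f-trl : Trail → FCtx → FCtx
  f-ι   : Vec Term 9 → Fin 9 → FCtx → FCtx
  f-sub : FCtx → Subst → FCtx

plug : FCtx → Term → Term
plug ■ X = X
plug (f-lam F) X = ƛ (plug F X)
plug (f-appL F N) X = plug F X · N
plug (f-appR M F) X = M · plug F X
plug (f-letL F N) X = tlet (plug F X) N
plug (f-letR M F) X = tlet M (plug F X)
plug (f-trl q F) X = q ▷ plug F X
plug (f-ι ϑ i F) X = ι (ϑ [ i ]≔ plug F X)
plug (f-sub F s) X = plug F X ⟦ s ⟧

infix 3 _⟶β_ _⟶βs_

mutual
  data _⟶β_ : Term → Term → Set where
    β-lam : ∀ {M N} →
      ƛ M · N ⟶β t (app (lam (tl M)) (tl N)) ba ▷ (er M ⟦ er N ⟧₁)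
    β-let : ∀ {q M N} →
      tlet (bang q M) N ⟶β t (qlet r (tl N)) bb ▷ (er N ⟦ q ▷ M ⟧₁)
    β-ι : ∀ {q q' ϑ P} (F : FCtx) →
      IsNFOf (t q (tl (plug F (ι ϑ)))) q' → TrailApp ϑ q' P →
      bang q (plug F (ι ϑ)) ⟶β bang q (plug F (ti ▷ P))
    e-lam  : ∀ {M M'} → M ⟶β M' → ƛ M ⟶β ƛ M'
    e-appL : ∀ {M M' N} → M ⟶β M' → M · N ⟶β M' · N
    e-appR : ∀ {M N N'} → N ⟶β N' → M · N ⟶β M · N'
    e-letL : ∀ {M M' N} → M ⟶β M' → tlet M N ⟶β tlet M' N
    e-letR : ∀ {M N N'} → N ⟶β N' → tlet M N ⟶β tlet M N'
    e-bang : ∀ {q M M'} → M ⟶β M' → bang q M ⟶β bang q M'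
    e-trl  : ∀ {q M M'} → M ⟶β M' → q ▷ M ⟶β q ▷ M'
    e-ι    : ∀ {ϑ M'} (i : Fin 9) → lookup ϑ i ⟶β M' → ι ϑ ⟶β ι (ϑ [ i ]≔ M')
    e-subM : ∀ {M M' s} → M ⟶β M' → M ⟦ s ⟧ ⟶β M' ⟦ s ⟧
    e-subS : ∀ {M s s'} → s ⟶βs s' → M ⟦ s ⟧ ⟶β M ⟦ s' ⟧

  data _⟶βs_ : Subst → Subst → Set where
    s-compL : ∀ {s s' u} → s ⟶βs s' → s ∘ₛ u ⟶βs s' ∘ₛ u
    s-compR : ∀ {s u u'} → u ⟶βs u' → s ∘ₛ u ⟶βs s ∘ₛ u'
    s-consM : ∀ {M M' s} → M ⟶β M' → M • s ⟶βs M' • s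
    s-consS : ∀ {M s s'} → s ⟶βs s' → M • s ⟶βs M • s'

_⟶CAU_ : Term → Term → Set
M ⟶CAU N = (M ⟶β N) ⊎ (M ≡στ N)

_⟶CAU*_ : Term → Term → Set
_⟶CAU*_ = Star _⟶CAU_

mutual
  data PureTrail : Trail → Set where
    p-r   : PureTrail r
    p-t   : ∀ {q q'} → PureTrail q → PureTrail q' → PureTrail (t q q')
    p-ba  : PureTrail ba
    p-bb  : PureTrail bb
    p-ti  : PureTrail ti
    p-lam : ∀ {q} → PureTrail q → PureTrail (lam q)
    p-app : ∀ {q q'} → PureTrail q → PureTrail q' → PureTrail (app q q')
    p-let : ∀ {q q'} → PureTrail q → PureTrail q' → PureTrail (qlet q q')
    p-tr  : ∀ {ζ} → (∀ i → PureTrail (lookup ζ i)) → PureTrail (tr ζ)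

  data Pure : Term → Set where
    p-idx  : ∀ n → Pure (idx (suc n))
    p-lamT : ∀ {M} → Pure M → Pure (ƛ M)
    p-appT : ∀ {M N} → Pure M → Pure N → Pure (M · N)
    p-letT : ∀ {M N} → Pure M → Pure N → Pure (tlet M N)
    p-bang : ∀ {q M} → PureTrail q → Pure M → Pure (bang q M)
    p-trl  : ∀ {q M} → PureTrail q → Pure M → Pure (q ▷ M)
    p-ι    : ∀ {ϑ} → (∀ i → Pure (lookup ϑ i)) → Pure (ι ϑ)

mutual
  data IsClosure : Term → Set where
    c-er   : ∀ {M e} → Pure M → IsEnv e → IsClosure (er (ƛ M ⟦ e ⟧))
    c-bang : ∀ {q C} → IsClosure C → IsClosure (bang q C)

  data IsValue : Term → Set where
    v-trl : ∀ {q C} → IsClosure C → IsValue (q ▷ C)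

  data IsEnv : Subst → Set where
    env-nil  : IsEnv ⟨⟩
    env-cons : ∀ {V e} → IsValue V → IsEnv e → IsEnv (V • e)

-- lookup e(n), 1-based; partial (nothing when undefined)
lookupEnv : Subst → ℕ → Maybe Term
lookupEnv ((q ▷ C) • e) (suc zero)    = just C
lookupEnv (V • e)       (suc (suc m)) = lookupEnv e (suc m)
lookupEnv _             _             = nothing

-- Free de Bruijn indices (0-based here: Free i X means index i+1 occurs
-- free in X).  FreeS i s j : index i+1 occurs free in s(j+1), i.e. in the
-- term that the substitution s assigns to index j+1.

mutual
  data Free : ℕ → Term → Set where
    fr-one  : Free 0 one
    fr-lam  : ∀ {i M} → Free (suc i) M → Free i (ƛ M)
    fr-appL : ∀ {i M N} → Free i M → Free i (M · N)
    fr-appR : ∀ {i M N} → Free i N → Free i (M · N)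
    fr-letL : ∀ {i M N} → Free i M → Free i (tlet M N)
    fr-letR : ∀ {i M N} → Free (suc i) N → Free i (tlet M N)
    fr-bangQ : ∀ {i q M} → FreeQ i q → Free i (bang q M)
    fr-bangM : ∀ {i q M} → Free i M → Free i (bang q M)
    fr-trlQ : ∀ {i q M} → FreeQ i q → Free i (q ▷ M)
    fr-trlM : ∀ {i q M} → Free i M → Free i (q ▷ M)
    fr-ι    : ∀ {i ϑ} (j : Fin 9) → Free i (lookup ϑ j) → Free i (ι ϑ)
    fr-sub  : ∀ {i j M s} → Free j M → FreeS i s j → Free i (M ⟦ s ⟧)
    fr-er   : ∀ {i M} → Free i M → Free i (er M)

  data FreeQ : ℕ → Trail → Set where
    fq-tL  : ∀ {i q q'} → FreeQ i q → FreeQ i (t q q')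
    fq-tR  : ∀ {i q q'} → FreeQ i q' → FreeQ i (t q q')
    fq-lam : ∀ {i q} → FreeQ i q → FreeQ i (lam q)
    fq-appL : ∀ {i q q'} → FreeQ i q → FreeQ i (app q q')
    fq-appR : ∀ {i q q'} → FreeQ i q' → FreeQ i (app q q')
    fq-letL : ∀ {i q q'} → FreeQ i q → FreeQ i (qlet q q')
    fq-letR : ∀ {i q q'} → FreeQ i q' → FreeQ i (qlet q q')
    fq-tr  : ∀ {i ζ} (j : Fin 9) → FreeQ i (lookup ζ j) → FreeQ i (tr ζ)
    fq-tl  : ∀ {i M} → Free i M → FreeQ i (tl M)

  data FreeS : ℕ → Subst → ℕ → Set where
    fs-id    : ∀ {j} → FreeS j ⟨⟩ j
    fs-shift : ∀ {j} → FreeS (suc j) ↑ j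
    fs-here  : ∀ {i M s} → Free i M → FreeS i (M • s) 0
    fs-there : ∀ {i j M s} → FreeS i s j → FreeS i (M • s) (suc j)
    fs-comp  : ∀ {i j k s u} → FreeS k s j → FreeS i u k → FreeS i (s ∘ₛ u) j

Closed : Term → Set
Closed M = ∀ i → ¬ Free i M

-- A closure er((λ.M)[e]) is στ-convertible to a term on which er acts as the identity:
-- pushing the substitution and the erasure into the pure body replaces every variable
-- either by a variable or, recursively, by a closure of the environment (already in that
-- form up to an outer trail, which er discards), while banged subterms are left untouched.
-- Hence er C ≡στ C for every closure C, and er(n[e]) ≡στ er(q ▷ C) ≡στ er C ≡στ C = e(n).
module Submission where

open import Defs
open import Data.Nat using (ℕ; zero; suc; _≤_; s≤s; z≤n)
open import Data.Fin using () renaming (zero to f0; suc to fs)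
open import Data.Vec using (Vec; []; _∷_; map; lookup; _[_]≔_)
open import Data.Vec.Properties using (map-∘)
open import Data.Vec.Relation.Binary.Pointwise.Inductive using (Pointwise; []; _∷_)
open import Data.Maybe using (just)
open import Data.Product using (Σ; ∃-syntax; _×_; _,_)
open import Data.Sum using (inj₂)
open import Data.Empty using (⊥-elim)
open import Relation.Nullary using (¬_)
open import Relation.Binary.PropositionalEquality using (_≡_; refl; subst)
open import Relation.Binary.Construct.Closure.ReflexiveTransitive using (ε; _◅_; _◅◅_)
open import Relation.Binary.Construct.Closure.Symmetric using (fwd; bwd)
open import Relation.Binary.Construct.Closure.Equivalence using (EqClosure; gmap; symmetric)

infix 3 _≈_ _≈ₛ_

_≈_ : Term → Term → Set
_≈_ = _≡στ_

_≈ₛ_ : Subst → Subst → Set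
_≈ₛ_ = EqClosure _⟶στs_

rule : ∀ {M N} → RootT M N → M ≈ N
rule ρ = fwd (root ρ) ◅ ε

rule⁻¹ : ∀ {M N} → RootT N M → M ≈ N
rule⁻¹ ρ = bwd (root ρ) ◅ ε

ruleₛ : ∀ {s u} → RootS s u → s ≈ₛ u
ruleₛ ρ = fwd (root ρ) ◅ ε

ruleₛ⁻¹ : ∀ {s u} → RootS u s → s ≈ₛ u
ruleₛ⁻¹ ρ = bwd (root ρ) ◅ ε

≈-sym : ∀ {M N} → M ≈ N → N ≈ M
≈-sym = symmetric _⟶στ_

ƛ-cong : ∀ {M M'} → M ≈ M' → ƛ M ≈ ƛ M'
ƛ-cong = gmap ƛ c-lam

·-cong : ∀ {M M' N N'} → M ≈ M' → N ≈ N' → M · N ≈ M' · N'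
·-cong {M' = M'} {N = N} p q = gmap (_· N) c-appL p ◅◅ gmap (M' ·_) c-appR q

tlet-cong : ∀ {M M' N N'} → M ≈ M' → N ≈ N' → tlet M N ≈ tlet M' N'
tlet-cong {M' = M'} {N = N} p q = gmap (λ X → tlet X N) c-letL p ◅◅ gmap (tlet M') c-letR q

▷-cong : ∀ q {M M'} → M ≈ M' → q ▷ M ≈ q ▷ M'
▷-cong q = gmap (q ▷_) c-trlM

⟦⟧-congˡ : ∀ s {M M'} → M ≈ M' → M ⟦ s ⟧ ≈ M' ⟦ s ⟧
⟦⟧-congˡ s = gmap (_⟦ s ⟧) c-subM

⟦⟧-congʳ : ∀ M {s s'} → s ≈ₛ s' → M ⟦ s ⟧ ≈ M ⟦ s' ⟧
⟦⟧-congʳ M = gmap (M ⟦_⟧) c-subS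

er-cong : ∀ {M M'} → M ≈ M' → er M ≈ er M'
er-cong = gmap er c-er

∘ₛ-congʳ : ∀ s {u u'} → u ≈ₛ u' → s ∘ₛ u ≈ₛ s ∘ₛ u'
∘ₛ-congʳ s = gmap (s ∘ₛ_) c-compR

pointwise-cong : ∀ {n} (K : Vec Term n → Term) →
                 (∀ {ϑ M'} i → lookup ϑ i ⟶στ M' → K ϑ ⟶στ K (ϑ [ i ]≔ M')) →
                 ∀ {ϑ ϑ'} → Pointwise _≈_ ϑ ϑ' → K ϑ ≈ K ϑ'
pointwise-cong K step [] = ε
pointwise-cong K step {x ∷ xs} {y ∷ ys} (p ∷ ps) =
  gmap (λ z → K (z ∷ xs)) (step f0) p ◅◅ pointwise-cong (λ v → K (y ∷ v)) (λ i → step (fs i)) ps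

ι-cong : ∀ {ϑ ϑ'} → Pointwise _≈_ ϑ ϑ' → ι ϑ ≈ ι ϑ'
ι-cong = pointwise-cong ι c-ι

ups-∘-↑ : ∀ k → ups k ∘ₛ ↑ ≈ₛ ups (suc k)
ups-∘-↑ zero    = ε
ups-∘-↑ (suc k) = ruleₛ s-assoc ◅◅ ∘ₛ-congʳ ↑ (ups-∘-↑ k)

ups-∘-⟨⟩ : ∀ k → ups k ∘ₛ ⟨⟩ ≈ₛ ups k
ups-∘-⟨⟩ zero    = ruleₛ s-shid
ups-∘-⟨⟩ (suc k) = ruleₛ s-assoc ◅◅ ∘ₛ-congʳ ↑ (ups-∘-⟨⟩ k)

ups-suc-∘-• : ∀ k {X u} → ups (suc k) ∘ₛ (X • u) ≈ₛ ups k ∘ₛ u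
ups-suc-∘-• zero    = ruleₛ s-assoc ◅◅ ∘ₛ-congʳ ↑ (ruleₛ s-shcons)
ups-suc-∘-• (suc k) = ruleₛ s-assoc ◅◅ ∘ₛ-congʳ ↑ (ups-suc-∘-• k) ◅◅ ruleₛ⁻¹ s-assoc

idx-⟦•⟧ : ∀ m {X u} → idx (suc (suc m)) ⟦ X • u ⟧ ≈ idx (suc m) ⟦ u ⟧
idx-⟦•⟧ zero    = rule σ-clos ◅◅ ⟦⟧-congʳ one (ruleₛ s-shcons)
idx-⟦•⟧ (suc k) = rule σ-clos ◅◅ ⟦⟧-congʳ one (ups-suc-∘-• k) ◅◅ rule⁻¹ σ-clos

idx-⟦↑⟧ : ∀ m → idx (suc m) ⟦ ↑ ⟧ ≈ idx (suc (suc m))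
idx-⟦↑⟧ zero    = ε
idx-⟦↑⟧ (suc k) = rule σ-clos ◅◅ ⟦⟧-congʳ one (ups-∘-↑ k)

idx-⟦⟨⟩⟧ : ∀ m → idx (suc m) ⟦ ⟨⟩ ⟧ ≈ idx (suc m)
idx-⟦⟨⟩⟧ zero    = rule σ-id
idx-⟦⟨⟩⟧ (suc k) = rule σ-clos ◅◅ ⟦⟧-congʳ one (ups-∘-⟨⟩ k)

idx-⟦∘↑⟧ : ∀ m s → idx (suc m) ⟦ s ∘ₛ ↑ ⟧ ≈ idx (suc m) ⟦ s ⟧ ⟦ ↑ ⟧
idx-⟦∘↑⟧ zero    s = rule⁻¹ σ-clos
idx-⟦∘↑⟧ (suc k) s =
  rule σ-clos ◅◅ ⟦⟧-congʳ one (ruleₛ⁻¹ s-assoc) ◅◅ rule⁻¹ σ-clos ◅◅ ⟦⟧-congˡ ↑ (rule⁻¹ σ-clos)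

lift : Subst → Subst
lift s = one • (s ∘ₛ ↑)

idx-⟦lift⟧ : ∀ m s → idx (suc (suc m)) ⟦ lift s ⟧ ≈ idx (suc m) ⟦ s ⟧ ⟦ ↑ ⟧
idx-⟦lift⟧ m s = idx-⟦•⟧ m ◅◅ idx-⟦∘↑⟧ m s

MapsInto : (Term → Set) → Subst → Set
MapsInto P s = ∀ n → ∃[ Y ] P Y × idx (suc n) ⟦ s ⟧ ≈ Y

ClosedUnderWeakening : (Term → Set) → Set
ClosedUnderWeakening P = ∀ {Y} → P Y → ∃[ Y' ] P Y' × Y ⟦ ↑ ⟧ ≈ Y'

lift-mapsInto : ∀ {P s} → P one → ClosedUnderWeakening P → MapsInto P s → MapsInto P (lift s)
lift-mapsInto p₁ weaken σ zero = one , p₁ , rule σ-cons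
lift-mapsInto {s = s} p₁ weaken σ (suc n) =
  let (Y , pY , p) = σ n
      (Y' , pY' , q) = weaken pY
  in Y' , pY' , idx-⟦lift⟧ n s ◅◅ ⟦⟧-congˡ ↑ p ◅◅ q

data IsIndex : Term → Set where
  idxᴵ : ∀ m → IsIndex (idx (suc m))

index-weaken : ClosedUnderWeakening IsIndex
index-weaken (idxᴵ m) = idx (suc (suc m)) , idxᴵ (suc m) , idx-⟦↑⟧ m

IsRenaming : Subst → Set
IsRenaming = MapsInto IsIndex

↑-renaming : IsRenaming ↑
↑-renaming n = idx (suc (suc n)) , idxᴵ (suc n) , idx-⟦↑⟧ n

lift-renaming : ∀ {s} → IsRenaming s → IsRenaming (lift s)
lift-renaming = lift-mapsInto (idxᴵ zero) index-weaken

-- bangᴱ has no premise because er(!_q M) → !_q M does not erase inside M.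
data Erased : Term → Set where
  idxᴱ  : ∀ n → Erased (idx (suc n))
  ƛᴱ    : ∀ {M} → Erased M → Erased (ƛ M)
  ·ᴱ    : ∀ {M N} → Erased M → Erased N → Erased (M · N)
  tletᴱ : ∀ {M N} → Erased M → Erased N → Erased (tlet M N)
  bangᴱ : ∀ {q M} → Erased (bang q M)
  ιᴱ    : ∀ {ϑ} → (∀ i → Erased (lookup ϑ i)) → Erased (ι ϑ)

index-erased : ∀ {Y} → IsIndex Y → Erased Y
index-erased (idxᴵ m) = idxᴱ m

HasErasedForm : Term → Set
HasErasedForm M = ∃[ N ] Erased N × M ≈ N

HasErasedForms : ∀ {n} → Vec Term n → Set
HasErasedForms {n} ϑ = ∃[ ϑ' ] (∀ i → Erased (lookup {n = n} ϑ' i)) × Pointwise _≈_ ϑ ϑ'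

map-erased-forms : ∀ {n} (f : Term → Term) {ϑ : Vec Term n} →
                   (∀ i → HasErasedForm (f (lookup ϑ i))) → HasErasedForms (map f ϑ)
map-erased-forms f {[]}    h = [] , (λ ()) , []
map-erased-forms f {_ ∷ _} h =
  let (N , e , p) = h f0
      (ϑ' , es , ps) = map-erased-forms f (λ i → h (fs i))
  in N ∷ ϑ' , (λ { f0 → e ; (fs i) → es i }) , p ∷ ps

map-pointwise-fixed : ∀ {n} (f : Term → Term) {ϑ : Vec Term n} →
                      (∀ i → f (lookup ϑ i) ≈ lookup ϑ i) → Pointwise _≈_ (map f ϑ) ϑ
map-pointwise-fixed f {[]}    h = []
map-pointwise-fixed f {_ ∷ _} h = h f0 ∷ map-pointwise-fixed f (λ i → h (fs i))

ι-erased-form : ∀ {ϑ} → HasErasedForms ϑ → HasErasedForm (ι ϑ)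
ι-erased-form (ϑ' , es , ps) = ι ϑ' , ιᴱ es , ι-cong ps

er-idx : ∀ n → er (idx (suc n)) ≈ idx (suc n)
er-idx zero    = rule er-one
er-idx (suc k) = rule (er-var k)

er-erased : ∀ {N} → Erased N → er N ≈ N
er-erased (idxᴱ n)      = er-idx n
er-erased (ƛᴱ e)        = rule er-lam ◅◅ ƛ-cong (er-erased e)
er-erased (·ᴱ e₁ e₂)    = rule er-app ◅◅ ·-cong (er-erased e₁) (er-erased e₂)
er-erased (tletᴱ e₁ e₂) = rule er-let ◅◅ tlet-cong (er-erased e₁) (er-erased e₂)
er-erased bangᴱ         = rule er-bang
er-erased (ιᴱ es)       = rule er-ι ◅◅ ι-cong (map-pointwise-fixed er (λ i → er-erased (es i)))

rename-erased : ∀ {N s} → Erased N → IsRenaming s → HasErasedForm (N ⟦ s ⟧)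
rename-erased (idxᴱ n) ρ = let (Y , i , p) = ρ n in Y , index-erased i , p
rename-erased (ƛᴱ e) ρ =
  let (N , e' , p) = rename-erased e (lift-renaming ρ)
  in ƛ N , ƛᴱ e' , rule σ-lam ◅◅ ƛ-cong p
rename-erased (·ᴱ e₁ e₂) ρ =
  let (N₁ , e₁' , p₁) = rename-erased e₁ ρ
      (N₂ , e₂' , p₂) = rename-erased e₂ ρ
  in N₁ · N₂ , ·ᴱ e₁' e₂' , rule σ-app ◅◅ ·-cong p₁ p₂
rename-erased (tletᴱ e₁ e₂) ρ =
  let (N₁ , e₁' , p₁) = rename-erased e₁ ρ
      (N₂ , e₂' , p₂) = rename-erased e₂ (lift-renaming ρ)
  in tlet N₁ N₂ , tletᴱ e₁' e₂' , rule σ-let ◅◅ tlet-cong p₁ p₂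
rename-erased {s = s} (bangᴱ {q} {M}) ρ = bang q (M ⟦ s ⟧) , bangᴱ , rule σ-bang
rename-erased {s = s} (ιᴱ es) ρ =
  let (N , e , p) = ι-erased-form (map-erased-forms (_⟦ s ⟧) (λ i → rename-erased (es i) ρ))
  in N , e , rule σ-ι ◅◅ p

data ErasedUpToTrail : Term → Set where
  bare    : ∀ {N} → Erased N → ErasedUpToTrail N
  trailed : ∀ q {N} → Erased N → ErasedUpToTrail (q ▷ N)

er-erasedUpToTrail : ∀ {Y} → ErasedUpToTrail Y → HasErasedForm (er Y)
er-erasedUpToTrail (bare e)      = _ , e , er-erased e
er-erasedUpToTrail (trailed q e) = _ , e , rule er-trl ◅◅ er-erased e

erasedUpToTrail-weaken : ClosedUnderWeakening ErasedUpToTrail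
erasedUpToTrail-weaken (bare e) =
  let (N , e' , p) = rename-erased e ↑-renaming in N , bare e' , p
erasedUpToTrail-weaken (trailed q e) =
  let (N , e' , p) = rename-erased e ↑-renaming in (q ▷ N) , trailed q e' , rule σ-trl ◅◅ ▷-cong q p

lift-erasedUpToTrail : ∀ {s} → MapsInto ErasedUpToTrail s → MapsInto ErasedUpToTrail (lift s)
lift-erasedUpToTrail = lift-mapsInto (bare (idxᴱ zero)) erasedUpToTrail-weaken

erase-pure : ∀ {M s} → Pure M → MapsInto ErasedUpToTrail s → HasErasedForm (er (M ⟦ s ⟧))
erase-pure (p-idx n) σ =
  let (Y , u , p) = σ n
      (N , e , q) = er-erasedUpToTrail u
  in N , e , er-cong p ◅◅ q
erase-pure (p-lamT pM) σ =
  let (N , e , p) = erase-pure pM (lift-erasedUpToTrail σ)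
  in ƛ N , ƛᴱ e , er-cong (rule σ-lam) ◅◅ rule er-lam ◅◅ ƛ-cong p
erase-pure (p-appT pM pN) σ =
  let (M' , e₁ , p₁) = erase-pure pM σ
      (N' , e₂ , p₂) = erase-pure pN σ
  in M' · N' , ·ᴱ e₁ e₂ , er-cong (rule σ-app) ◅◅ rule er-app ◅◅ ·-cong p₁ p₂
erase-pure (p-letT pM pN) σ =
  let (M' , e₁ , p₁) = erase-pure pM σ
      (N' , e₂ , p₂) = erase-pure pN (lift-erasedUpToTrail σ)
  in tlet M' N' , tletᴱ e₁ e₂ , er-cong (rule σ-let) ◅◅ rule er-let ◅◅ tlet-cong p₁ p₂
erase-pure {s = s} (p-bang {q} {M} _ _) σ =
  bang q (M ⟦ s ⟧) , bangᴱ , er-cong (rule σ-bang) ◅◅ rule er-bang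
erase-pure (p-trl _ pM) σ =
  let (N , e , p) = erase-pure pM σ in N , e , er-cong (rule σ-trl) ◅◅ rule er-trl ◅◅ p
erase-pure {s = s} (p-ι {ϑ} pϑ) σ =
  let forms = map-erased-forms (λ M → er (M ⟦ s ⟧)) (λ i → erase-pure (pϑ i) σ)
      (N , e , p) = ι-erased-form (subst HasErasedForms (map-∘ er (_⟦ s ⟧) ϑ) forms)
  in N , e , er-cong (rule σ-ι) ◅◅ rule er-ι ◅◅ p

mutual
  closure-erased : ∀ {C} → IsClosure C → HasErasedForm C
  closure-erased (c-er pM ie)        = erase-pure (p-lamT pM) (env-erasedUpToTrail ie)
  closure-erased (c-bang {q} {C} _) = bang q C , bangᴱ , ε

  env-erasedUpToTrail : ∀ {e} → IsEnv e → MapsInto ErasedUpToTrail e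
  env-erasedUpToTrail env-nil n = idx (suc n) , bare (idxᴱ n) , idx-⟦⟨⟩⟧ n
  env-erasedUpToTrail (env-cons (v-trl {q} cl) ie) zero =
    let (N , e , p) = closure-erased cl in (q ▷ N) , trailed q e , rule σ-cons ◅◅ ▷-cong q p
  env-erasedUpToTrail (env-cons ie' ie) (suc n) =
    let (Y , u , p) = env-erasedUpToTrail ie n in Y , u , idx-⟦•⟧ n ◅◅ p

er-closure : ∀ {C} → IsClosure C → er C ≈ C
er-closure cl = let (N , e , p) = closure-erased cl in er-cong p ◅◅ er-erased e ◅◅ ≈-sym p

ups-FreeS-suc : ∀ {i j k} → FreeS i (ups k) j → FreeS (suc i) (ups k) (suc j)
ups-FreeS-suc {k = zero}  fs-shift                = fs-shift
ups-FreeS-suc {k = suc k} (fs-comp fs-shift free) = fs-comp fs-shift (ups-FreeS-suc free)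

ups-FreeS : ∀ k → FreeS (suc k) (ups k) 0
ups-FreeS zero    = fs-shift
ups-FreeS (suc k) = fs-comp fs-shift (ups-FreeS-suc (ups-FreeS k))

idx-⟦⟨⟩⟧-not-closed : ∀ m → ¬ Closed (idx (suc m) ⟦ ⟨⟩ ⟧)
idx-⟦⟨⟩⟧-not-closed zero    cl = cl zero (fr-sub fr-one fs-id)
idx-⟦⟨⟩⟧-not-closed (suc k) cl = cl (suc k) (fr-sub (fr-sub fr-one (ups-FreeS k)) fs-id)

Free-idx-suc : ∀ {j} m → Free j (idx (suc m)) → Free (suc j) (idx (suc (suc m)))
Free-idx-suc zero    fr-one               = fr-sub fr-one fs-shift
Free-idx-suc (suc k) (fr-sub fr-one free) = fr-sub fr-one (fs-comp fs-shift (ups-FreeS-suc free))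

closed-idx-⟦•⟧ : ∀ m {V e} → Closed (idx (suc (suc m)) ⟦ V • e ⟧) → Closed (idx (suc m) ⟦ e ⟧)
closed-idx-⟦•⟧ m cl i (fr-sub free freeS) = cl i (fr-sub (Free-idx-suc m free) (fs-there freeS))

er-idx-⟦env⟧ : ∀ {e} m → IsEnv e → Closed (idx (suc m) ⟦ e ⟧) →
               ∃[ C ] lookupEnv e (suc m) ≡ just C × er (idx (suc m) ⟦ e ⟧) ≈ C
er-idx-⟦env⟧ m env-nil cl = ⊥-elim (idx-⟦⟨⟩⟧-not-closed m cl)
er-idx-⟦env⟧ zero (env-cons (v-trl {C = C} cl) ie) _ =
  C , refl , er-cong (rule σ-cons) ◅◅ rule er-trl ◅◅ er-closure cl
er-idx-⟦env⟧ (suc m) (env-cons (v-trl _) ie) cl =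
  let (C , eq , p) = er-idx-⟦env⟧ m ie (closed-idx-⟦•⟧ m cl)
  in C , eq , er-cong (idx-⟦•⟧ m) ◅◅ p

lemma14 : (e : Subst) (n : ℕ) → IsEnv e → 1 ≤ n → Closed (idx n ⟦ e ⟧) →
          Σ Term (λ C → (lookupEnv e n ≡ just C) × (er (idx n ⟦ e ⟧) ⟶CAU* C))
lemma14 e (suc m) ie (s≤s z≤n) cl =
  let (C , eq , p) = er-idx-⟦env⟧ m ie cl in C , eq , inj₂ p ◅ ε
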